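{- If a finite bipartite graph $G$ contains an edge-asteroid, then it contains an invertible pair.
   Context: Let $(X,Y)$ be a bipartition of $G$. Two edges $xy,x'y'$ ($x,x'\in X$, $y,y'\in Y$) are independent if $x\ne x'$, $y\ne y'$, and $xy'\notin E(G)$, $x'y\notin E(G)$. Two walks $a_1\dots a_k$ and $b_1\dots b_k$ with $a_1,b_1$ in the same part are congruent if for each $i=1,\dots,k-1$ the edges $a_ia_{i+1}$ and $b_ib_{i+1}$ are independent. A pair of vertices $u,v$ is an invertible pair if there are congruent walks $W$ from $u$ to $v$ and $W'$ from $v$ to $u$. An edge-asteroid in $G$ is a set of an odd number $2k+1$ ($k\ge1$) of edges $e_0,\dots,e_{2k}$ such that for each $i$ there is a walk joining $e_{i+k}$ and $e_{i+k+1}$ (a walk containing both end vertices of $e_{i+k}$ and both end vertices of $e_{i+k+1}$) that contains no vertex adjacent to either end vertex of $e_i$ (indices modulo $2k+1$). -}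

module Defs where

open import Data.Nat public using (ℕ)

open import Data.Nat using (ℕ; zero; suc; _+_; _*_)
import Data.Nat
open import Data.Nat.DivMod using (_mod_)
open import Data.Fin using (Fin; toℕ; inject₁)
open import Data.Bool using (Bool; true; false)
open import Data.Vec using (Vec; head; last; lookup)
open import Data.Vec.Membership.Propositional using (_∈_)
open import Data.Product using (Σ; ∃; _×_; _,_)
open import Relation.Nullary using (¬_)
open import Relation.Binary.PropositionalEquality using (_≡_; _≢_)

-- A finite simple bipartite graph on the vertex set Fin n, together with a
-- fixed bipartition (X,Y): X = vertices with side v ≡ true, Y = side v ≡ false.
record BipGraph (n : ℕ) : Set₁ where
  field
    Adj       : Fin n → Fin n → Set
    sym       : ∀ {u v} → Adj u v → Adj v u
    irrefl    : ∀ {u} → ¬ Adj u u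
    side      : Fin n → Bool
    bipartite : ∀ {u v} → Adj u v → side u ≢ side v

module _ {n : ℕ} (G : BipGraph n) where
  open BipGraph G

  InX : Fin n → Set
  InX v = side v ≡ true

  InY : Fin n → Set
  InY v = side v ≡ false

  Independent : (x y x' y' : Fin n) → Set
  Independent x y x' y' =
    InX x × InY y × InX x' × InY y' ×
    Adj x y × Adj x' y' ×
    x ≢ x' × y ≢ y' × ¬ Adj x y' × ¬ Adj x' y

  -- Independence of the edges ab and a'b' (a, a' in the same part), where
  -- each edge is written with its X-endpoint first as in the definition.
  IndependentEdges : (a b a' b' : Fin n) → Set
  IndependentEdges a b a' b' with side a
  ... | true  = Independent a b a' b'
  ... | false = Independent b a b' a'

  -- A walk a₀ … a_k (k edges) as a vector of its k+1 vertices.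
  IsWalk : ∀ {k} → Vec (Fin n) (suc k) → Set
  IsWalk {k} w = (i : Fin k) → Adj (lookup w (inject₁ i)) (lookup w (Fin.suc i))

  Congruent : ∀ {k} → Vec (Fin n) (suc k) → Vec (Fin n) (suc k) → Set
  Congruent {k} a b =
    IsWalk a × IsWalk b × side (head a) ≡ side (head b) ×
    ((i : Fin k) → IndependentEdges (lookup a (inject₁ i)) (lookup a (Fin.suc i))
                                    (lookup b (inject₁ i)) (lookup b (Fin.suc i)))

  InvertiblePair : Fin n → Fin n → Set
  InvertiblePair u v =
    u ≢ v ×
    Σ ℕ λ k → Σ (Vec (Fin n) (suc k)) λ W → Σ (Vec (Fin n) (suc k)) λ W' →
      head W ≡ u × last W ≡ v × head W' ≡ v × last W' ≡ u × Congruent W W'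

  HasInvertiblePair : Set
  HasInvertiblePair = Σ (Fin n) λ u → Σ (Fin n) λ v → InvertiblePair u v

  Edge : Set
  Edge = Σ (Fin n) λ u → Σ (Fin n) λ v → Adj u v

  AvoidingJoiningWalk : Edge → Edge → Edge → Set
  AvoidingJoiningWalk (u , v , _) (u' , v' , _) (x , y , _) =
    Σ ℕ λ k → Σ (Vec (Fin n) (suc k)) λ W →
      IsWalk W × u ∈ W × v ∈ W × u' ∈ W × v' ∈ W ×
      (∀ {w} → w ∈ W → ¬ Adj w x × ¬ Adj w y)

  EdgeAsteroid : Set
  EdgeAsteroid =
    Σ ℕ λ k → Σ (Fin (suc (2 * k)) → Edge) λ e →
      1 Data.Nat.≤ k ×
      ((i : Fin (suc (2 * k))) →
        AvoidingJoiningWalk (e ((toℕ i + k) mod suc (2 * k)))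
                            (e ((toℕ i + k + 1) mod suc (2 * k)))
                            (e i))

module Submission where

-- Read a pair of congruent walks as one walk in the "pair graph" whose
-- vertices are ordered pairs (a , b) and whose steps (a , b) ⇝ (c , d) are
-- pairs of independent edges ac, bd.  A pair u ≠ v is invertible exactly
-- when (u , v) reaches (v , u) in the pair graph.
--
-- 1. If a walk W avoids the neighbourhood of an edge xy, then W together
--    with the walk oscillating along xy is a congruent pair; hence any two
--    X-vertices a, a' of W satisfy (a , x) ⇝* (a' , x).
-- 2. Let P t be the X-end of the edge e_(t mod 2k+1).  The joining walks of
--    the asteroid give (P (t+k) , P t) ⇝* (P (t+k+1) , P t) for every t.
-- 3. A purely combinatorial lemma about odd cycles: for any swap-invariant
--    step relation, such moves for all t compose to (P k , P 0) ⇝* (P 0 , P k).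
-- 4. Since P k avoids the neighbourhood of e_0, P k ≠ P 0, and the walk in
--    the pair graph unfolds into congruent walks; this is the invertible pair.

open import Defs
open import Data.Nat using (ℕ; zero; suc; _+_; _*_; _%_; NonZero)
open import Data.Nat.DivMod using (_mod_; m%n<n; m%n%n≡m%n; %-distribˡ-+; %-remove-+ˡ)
open import Data.Nat.Divisibility using (∣-refl)
open import Data.Nat.Properties using (+-comm)
open import Data.Nat.Solver using (module +-*-Solver)
open import Data.Fin using (Fin; toℕ)
open import Data.Fin.Properties using (toℕ-fromℕ<; fromℕ<-cong)
open import Data.Bool using (true; false; if_then_else_)
open import Data.Vec using (Vec; head; last; _∷_; [])
open import Data.Vec.Membership.Propositional using (_∈_)
open import Data.Vec.Relation.Unary.Any using (here; there)
open import Data.Product using (Σ; _×_; _,_; proj₁; proj₂; swap)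
open import Data.Sum using (_⊎_; inj₁; inj₂)
import Data.Sum as Sum
open import Data.Empty using (⊥-elim)
open import Function using (_∘_)
open import Relation.Nullary using (¬_)
open import Relation.Binary.PropositionalEquality
open import Relation.Binary.Construct.Closure.ReflexiveTransitive
  using (Star; ε; _◅_; _◅◅_; gmap; reverse)

module OddCycle {A : Set} (_⇝_ : A × A → A × A → Set)
  (⇝-swap : ∀ {a b c d} → (a , b) ⇝ (c , d) → (b , a) ⇝ (d , c)) where

  swap* : ∀ {a b c d} → Star _⇝_ (a , b) (c , d) → Star _⇝_ (b , a) (d , c)
  swap* = gmap swap ⇝-swap

  odd-cycle-swap : (k : ℕ) (P : ℕ → A) → (∀ t → P (suc (2 * k) + t) ≡ P t) →
    (∀ t → Star _⇝_ (P (t + k) , P t) (P (suc (t + k)) , P t)) →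
    Star _⇝_ (P k , P 0) (P 0 , P k)
  odd-cycle-swap k P period advance =
    subst (λ p → Star _⇝_ (P k , P 0) (p , P k)) (wrap 0) (diagonal k ◅◅ advance k)
    where
    wrap : ∀ s → P (suc (s + k) + k) ≡ P s
    wrap s = trans (cong P (around s)) (period s)
      where
      open +-*-Solver
      around : ∀ s → suc (s + k) + k ≡ suc (2 * k) + s
      around = λ s → solve 2 (λ s k → con 1 :+ s :+ k :+ k := con 1 :+ con 2 :* k :+ s) refl s k

    -- Move the first coordinate forward (at t = s), then the second one: by
    -- symmetry this is the move at t = s + k + 1, read around the cycle.
    diagonal : ∀ s → Star _⇝_ (P k , P 0) (P (s + k) , P s)
    diagonal zero    = ε
    diagonal (suc s) = diagonal s ◅◅ advance s ◅◅ second-forward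
      where
      second-forward : Star _⇝_ (P (suc (s + k)) , P s) (P (suc (s + k)) , P (suc s))
      second-forward = subst₂ (λ p q → Star _⇝_ (P (suc (s + k)) , p) (P (suc (s + k)) , q))
                         (wrap s) (wrap (suc s)) (swap* (advance (suc (s + k))))

module Residues {m : ℕ} .{{_ : NonZero m}} where

  mod-cong : ∀ {a b} → a % m ≡ b % m → a mod m ≡ b mod m
  mod-cong eq = fromℕ<-cong _ _ eq _ _

  %-shift : ∀ {a b} j → a % m ≡ b % m → (a + j) % m ≡ (b + j) % m
  %-shift {a} {b} j eq = begin
    (a + j) % m               ≡⟨ %-distribˡ-+ a j m ⟩
    (a % m + j % m) % m       ≡⟨ cong (λ r → (r + j % m) % m) eq ⟩
    (b % m + j % m) % m       ≡⟨ %-distribˡ-+ b j m ⟨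
    (b + j) % m               ∎
    where open ≡-Reasoning

  toℕ-mod : ∀ t → toℕ (t mod m) % m ≡ t % m
  toℕ-mod t = trans (cong (_% m) (toℕ-fromℕ< (m%n<n t m))) (m%n%n≡m%n t m)

  mod-periodic : ∀ t → (m + t) mod m ≡ t mod m
  mod-periodic t = mod-cong (%-remove-+ˡ t ∣-refl)

  cyclic-reindex : ∀ {B : Set} (R : B → B → B → Set) (j : ℕ) (f : Fin m → B) →
    (∀ i → R (f ((toℕ i + j) mod m)) (f ((toℕ i + j + 1) mod m)) (f i)) →
    ∀ t → R (f ((t + j) mod m)) (f (suc (t + j) mod m)) (f (t mod m))
  cyclic-reindex R j f h t =
    subst₂ (λ p q → R (f p) (f q) (f (t mod m)))
      (mod-cong (%-shift j (toℕ-mod t)))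
      (mod-cong (trans (%-shift 1 (%-shift j (toℕ-mod t))) (cong (_% m) (+-comm (t + j) 1))))
      (h (t mod m))

module PairGraph {n : ℕ} (G : BipGraph n) where
  open BipGraph G renaming (sym to adj-sym)

  V : Set
  V = Fin n

  _⇝_ : V × V → V × V → Set
  (a , b) ⇝ (c , d) = IndependentEdges G a c b d

  ie-split : ∀ {a c b d} → IndependentEdges G a c b d →
             Independent G a c b d ⊎ Independent G c a d b
  ie-split {a} ie with side a
  ... | true  = inj₁ (refl , proj₂ ie)
  ... | false = let (xc , _ , rest) = ie in inj₂ (xc , refl , rest)

  ie-join : ∀ {a c b d} → Independent G a c b d ⊎ Independent G c a d b →
            IndependentEdges G a c b d
  ie-join {a} i with side a in sa | i
  ... | true  | inj₁ (_ , rest)      = sa , rest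
  ... | true  | inj₂ (_ , () , _)
  ... | false | inj₁ (() , _)
  ... | false | inj₂ (xc , _ , rest) = xc , sa , rest

  independent-swap : ∀ {x y x' y'} → Independent G x y x' y' → Independent G x' y' x y
  independent-swap (xx , yy , xx' , yy' , xy , xy' , x≢x' , y≢y' , ¬xy' , ¬x'y) =
    xx' , yy' , xx , yy , xy' , xy , x≢x' ∘ sym , y≢y' ∘ sym , ¬x'y , ¬xy'

  ⇝-sym : ∀ {p q} → p ⇝ q → q ⇝ p
  ⇝-sym = ie-join ∘ Sum.swap ∘ ie-split

  ⇝-swap : ∀ {a b c d} → (a , b) ⇝ (c , d) → (b , a) ⇝ (d , c)
  ⇝-swap = ie-join ∘ Sum.map independent-swap independent-swap ∘ ie-split

  ⇝-sides : ∀ {a b c d} → (a , b) ⇝ (c , d) → side c ≡ side d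
  ⇝-sides st with ie-split st
  ... | inj₁ (_ , yc , _ , yd , _) = trans yc (sym yd)
  ... | inj₂ (xc , _ , xd , _)     = trans xc (sym xd)

  ⇝-adj : ∀ {a b c d} → (a , b) ⇝ (c , d) → Adj a c × Adj b d
  ⇝-adj st with ie-split st
  ... | inj₁ (_ , _ , _ , _ , ac , bd , _) = ac , bd
  ... | inj₂ (_ , _ , _ , _ , ca , db , _) = adj-sym ca , adj-sym db

  CongruentWalks : V → V → V → V → Set
  CongruentWalks a b c d =
    Σ ℕ λ k → Σ (Vec V (suc k)) λ W → Σ (Vec V (suc k)) λ W' →
      head W ≡ a × last W ≡ c × head W' ≡ b × last W' ≡ d × Congruent G W W'

  star⇒congruent : ∀ {a b c d} → side a ≡ side b → Star _⇝_ (a , b) (c , d) →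
                   CongruentWalks a b c d
  star⇒congruent {a} {b} ab ε =
    0 , a ∷ [] , b ∷ [] , refl , refl , refl , refl , (λ ()) , (λ ()) , ab , (λ ())
  star⇒congruent {a} {b} ab (st ◅ rest)
    with star⇒congruent (⇝-sides st) rest
  ... | k , c ∷ W , d ∷ W' , refl , endW , refl , endW' , walkW , walkW' , _ , steps =
    suc k , a ∷ c ∷ W , b ∷ d ∷ W' , refl , endW , refl , endW' ,
    (λ { Fin.zero → proj₁ (⇝-adj st) ; (Fin.suc i) → walkW i }) ,
    (λ { Fin.zero → proj₂ (⇝-adj st) ; (Fin.suc i) → walkW' i }) ,
    ab ,
    (λ { Fin.zero → st ; (Fin.suc i) → steps i })

  side-cases : ∀ v → side v ≡ true ⊎ side v ≡ false
  side-cases v with side v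
  ... | true  = inj₁ refl
  ... | false = inj₂ refl

  X→Y : ∀ {u v} → Adj u v → side u ≡ true → side v ≡ false
  X→Y {v = v} uv su with side v in sv
  ... | false = refl
  ... | true  = ⊥-elim (bipartite uv (trans su (sym sv)))

  Y→X : ∀ {u v} → Adj u v → side u ≡ false → side v ≡ true
  Y→X {v = v} uv su with side v in sv
  ... | true  = refl
  ... | false = ⊥-elim (bipartite uv (trans su (sym sv)))

  xend yend : Edge G → V
  xend (u , v , _) = if side u then u else v
  yend (u , v , _) = if side u then v else u

  xend-X : ∀ g → side (xend g) ≡ true
  xend-X (u , v , uv) with side u in su
  ... | true  = su
  ... | false = Y→X uv su

  yend-Y : ∀ g → side (yend g) ≡ false
  yend-Y (u , v , uv) with side u in su
  ... | true  = X→Y uv su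
  ... | false = su

  ends-adj : ∀ g → Adj (xend g) (yend g)
  ends-adj (u , v , uv) with side u
  ... | true  = uv
  ... | false = adj-sym uv

  xend-∈ : ∀ {k} {W : Vec V (suc k)} g → proj₁ g ∈ W → proj₁ (proj₂ g) ∈ W → xend g ∈ W
  xend-∈ (u , v , _) u∈W v∈W with side u
  ... | true  = u∈W
  ... | false = v∈W

  Avoids : Edge G → V → Set
  Avoids (u , v , _) w = ¬ Adj w u × ¬ Adj w v

  avoids-ends : ∀ g {w} → Avoids g w → ¬ Adj w (xend g) × ¬ Adj w (yend g)
  avoids-ends (u , v , _) av with side u
  ... | true  = av
  ... | false = swap av

  avoids-≢xend : ∀ g {w} → Avoids g w → w ≢ xend g
  avoids-≢xend g av refl = proj₂ (avoids-ends g av) (ends-adj g)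

  -- The walk along g oscillating with a walk that avoids g: the vertex of g
  -- on the same side as w.
  partner : Edge G → V → V
  partner g w = if side w then xend g else yend g

  partner-X : ∀ g {w} → side w ≡ true → partner g w ≡ xend g
  partner-X g sw rewrite sw = refl

  partner-Y : ∀ g {w} → side w ≡ false → partner g w ≡ yend g
  partner-Y g sw rewrite sw = refl

  oscillation-X : ∀ g {a a'} → side a ≡ true → Adj a a' → Avoids g a → Avoids g a' →
                  (a , xend g) ⇝ (a' , yend g)
  oscillation-X g {a} {a'} xa aa' av av' = ie-join (inj₁
    (xa , X→Y aa' xa , xend-X g , yend-Y g , aa' , ends-adj g ,
     (λ { refl → ¬ay (ends-adj g) }) , (λ { refl → ¬a'x (adj-sym (ends-adj g)) }) ,
     ¬ay , ¬a'x ∘ adj-sym))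
    where
    ¬ay  = proj₂ (avoids-ends g av)
    ¬a'x = proj₁ (avoids-ends g av')

  oscillation-step : ∀ g {a a'} → Adj a a' → Avoids g a → Avoids g a' →
                     (a , partner g a) ⇝ (a' , partner g a')
  oscillation-step g {a} {a'} aa' av av' with side-cases a
  ... | inj₁ xa = subst₂ (λ p q → (a , p) ⇝ (a' , q))
                    (sym (partner-X g xa)) (sym (partner-Y g (X→Y aa' xa)))
                    (oscillation-X g xa aa' av av')
  ... | inj₂ ya = subst₂ (λ p q → (a , p) ⇝ (a' , q))
                    (sym (partner-Y g ya)) (sym (partner-X g (Y→X aa' ya)))
                    (⇝-sym (oscillation-X g (Y→X aa' ya) (adj-sym aa') av' av))

  oscillation : ∀ g {k} (W : Vec V (suc k)) → IsWalk G W → (∀ {w} → w ∈ W → Avoids g w) →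
                ∀ {a} → a ∈ W → Star _⇝_ (head W , partner g (head W)) (a , partner g a)
  oscillation g (w ∷ []) walk av (here refl) = ε
  oscillation g (w ∷ w' ∷ W) walk av (here refl) = ε
  oscillation g (w ∷ w' ∷ W) walk av (there a∈W) =
    oscillation-step g (walk Fin.zero) (av (here refl)) (av (there (here refl)))
    ◅ oscillation g (w' ∷ W) (walk ∘ Fin.suc) (av ∘ there) a∈W

  avoiding-walk-link : ∀ g {k} (W : Vec V (suc k)) → IsWalk G W →
    (∀ {w} → w ∈ W → Avoids g w) → ∀ {a a'} → a ∈ W → a' ∈ W →
    side a ≡ true → side a' ≡ true → Star _⇝_ (a , xend g) (a' , xend g)
  avoiding-walk-link g W walk av {a} {a'} a∈W a'∈W xa xa' =
    subst₂ (λ p q → Star _⇝_ (a , p) (a' , q)) (partner-X g xa) (partner-X g xa')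
      (reverse ⇝-sym (oscillation g W walk av a∈W) ◅◅ oscillation g W walk av a'∈W)

  Linked : Edge G → Edge G → Edge G → Set
  Linked f f' g = Star _⇝_ (xend f , xend g) (xend f' , xend g) × xend f ≢ xend g

  joining-walk-link : ∀ f f' g → AvoidingJoiningWalk G f f' g → Linked f f' g
  joining-walk-link f@(_ , _ , _) f'@(_ , _ , _) g@(_ , _ , _)
                    (_ , W , walk , u∈W , v∈W , u'∈W , v'∈W , av) =
    avoiding-walk-link g W walk av (xend-∈ f u∈W v∈W) (xend-∈ f' u'∈W v'∈W)
      (xend-X f) (xend-X f') ,
    avoids-≢xend g (av (xend-∈ f u∈W v∈W))

proposition2p4 : {n : ℕ} (G : BipGraph n) → EdgeAsteroid G → HasInvertiblePair G
proposition2p4 G (k , e , _ , walks) =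
  P k , P 0 , proj₂ (link 0) ,
  star⇒congruent (trans (xend-X (e (k mod m))) (sym (xend-X (e (0 mod m)))))
    (odd-cycle-swap k P (λ t → cong (xend ∘ e) (mod-periodic t)) (proj₁ ∘ link))
  where
  open PairGraph G
  open OddCycle _⇝_ ⇝-swap
  m = suc (2 * k)
  open Residues {m}

  P : ℕ → V
  P t = xend (e (t mod m))

  link : ∀ t → Linked (e ((t + k) mod m)) (e (suc (t + k) mod m)) (e (t mod m))
  link = cyclic-reindex Linked k e λ i →
    joining-walk-link (e ((toℕ i + k) mod m)) (e ((toℕ i + k + 1) mod m)) (e i) (walks i)
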